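{- Let $(G,k)$ be a reduced instance of \textsc{Trivially Perfect Editing} and let $X$ be a small TP-modulator of $G$. Let $(T,\mathcal{B})$ be the universal clique decomposition of the trivially perfect graph $G-X$, with associated quasi-order $\preceq$ on $V(G)\setminus X$. For $u,v\in V(G)\setminus X$, if $u\prec v$ then $N^X(u)\supseteq N^X(v)$.
   Context: Graphs are finite, simple, undirected; a graph is trivially perfect if it has no induced $C_4$ or $P_4$. \textsc{Trivially Perfect Editing}: given $(G,k)$, decide if some $S\subseteq\binom{V(G)}{2}$, $|S|\le k$, makes $(V(G),E(G)\triangle S)$ trivially perfect. The instance $(G,k)$ is reduced if neither of the following holds: (i) there is a non-edge $uv$ such that the complement of $G[N(u)\cap N(v)]$ has a matching of size $\ge k+1$; (ii) there is an edge $uv$ and $k+1$ pairwise disjoint non-adjacent pairs $\{a,b\}$ with $a\in N(u)\setminus N[v]$, $b\in N(v)\setminus N[u]$. An obstruction is a 4-vertex set $W$ with $G[W]\cong C_4$ or $P_4$. $X\subseteq V(G)$ is a TP-modulator if every obstruction $W$ has $|W\cap X|\ge2$, and if $|W\cap X|=2$, $W\cap X=\{x_1,x_2\}$, $W\setminus X=\{y_1,y_2\}$, then $G[W]$ is not the $C_4$ $x_1-y_1-y_2-x_2-x_1$ nor the $P_4$ $x_1-y_1-y_2-x_2$; it is small if $|X|\le 4k$. A universal clique decomposition (UCD) of a trivially perfect graph $H$ is a pair $(T,\mathcal{B}=\{B_t\}_{t\in V(T)})$ with $T$ a rooted forest and $\mathcal{B}$ a partition of $V(H)$ into nonempty sets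 such that if $vw\in E(H)$, $v\in B_t$, $w\in B_s$, then $t=s$ or one of $t,s$ is an ancestor of the other, and for each node $t$, $B_t$ is exactly the set of universal vertices of $H[\bigcup_{s\in V(T_t)}B_s]$, where $T_t$ is the subtree rooted at $t$; it exists and is unique up to isomorphism. For $u\in B_t$, $v\in B_s$: $u\preceq v$ iff $t=s$ or $t$ is an ancestor of $s$; $u\prec v$ means $u\preceq v$ and not $v\preceq u$. For $v\notin X$, $N^X(v)=N(v)\cap X$. -}

module Defs where

open import Data.Nat using (ℕ; suc; _+_; _*_; _≤_)
open import Data.Bool using (Bool; true; false; if_then_else_)
open import Data.Fin using (Fin)
open import Data.Fin.Subset using (Subset; ∣_∣)
open import Data.Vec using (lookup)
open import Data.Maybe using (Maybe; just)
open import Data.Product using (Σ; ∃; _×_; _,_)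
open import Data.Sum using (_⊎_)
open import Data.Empty using (⊥)
open import Relation.Nullary using (¬_)
open import Relation.Binary.PropositionalEquality using (_≡_; _≢_)

record Graph : Set where
  field
    n      : ℕ
    adj    : Fin n → Fin n → Bool
    sym    : ∀ u v → adj u v ≡ adj v u
    irrefl : ∀ v → adj v v ≡ false

module _ (G : Graph) where
  open Graph G

  E : Fin n → Fin n → Set
  E u v = adj u v ≡ true

  -- u and v are non-adjacent (possibly equal)
  NE : Fin n → Fin n → Set
  NE u v = adj u v ≡ false

  Distinct4 : Fin n → Fin n → Fin n → Fin n → Set
  Distinct4 a b c d =
    a ≢ b × a ≢ c × a ≢ d × b ≢ c × b ≢ d × c ≢ d

  IsP4 : Fin n → Fin n → Fin n → Fin n → Set
  IsP4 a b c d = Distinct4 a b c d ×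
    E a b × E b c × E c d × NE a c × NE b d × NE a d

  IsC4 : Fin n → Fin n → Fin n → Fin n → Set
  IsC4 a b c d = Distinct4 a b c d ×
    E a b × E b c × E c d × E d a × NE a c × NE b d

  Obstruction : Fin n → Fin n → Fin n → Fin n → Set
  Obstruction a b c d = IsP4 a b c d ⊎ IsC4 a b c d

  InX : Subset n → Fin n → Set
  InX X v = lookup X v ≡ true

  OutX : Subset n → Fin n → Set
  OutX X v = lookup X v ≡ false

  ind : Subset n → Fin n → ℕ
  ind X v = if lookup X v then 1 else 0

  -- |{a,b,c,d} ∩ X| for four distinct vertices
  count4 : Subset n → Fin n → Fin n → Fin n → Fin n → ℕ
  count4 X a b c d = ind X a + ind X b + ind X c + ind X d

  IsTPModulator : Subset n → Set
  IsTPModulator X =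
    (∀ a b c d → Obstruction a b c d → 2 ≤ count4 X a b c d) ×
    (∀ x₁ y₁ y₂ x₂ → InX X x₁ → InX X x₂ → OutX X y₁ → OutX X y₂ →
       ¬ IsC4 x₁ y₁ y₂ x₂ × ¬ IsP4 x₁ y₁ y₂ x₂)

  IsSmallTPModulator : ℕ → Subset n → Set
  IsSmallTPModulator k X = IsTPModulator X × ∣ X ∣ ≤ 4 * k

  -- a b : Fin m → Fin n describe m pairwise disjoint pairs {a i , b i}
  DisjointPairs : ∀ {m} → (Fin m → Fin n) → (Fin m → Fin n) → Set
  DisjointPairs {m} a b =
    (∀ i j → a i ≡ a j → i ≡ j) ×
    (∀ i j → b i ≡ b j → i ≡ j) ×
    (∀ i j → a i ≢ b j)

  -- rule (i): non-edge uv such that the complement of G[N(u) ∩ N(v)]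
  -- has a matching of size ≥ k+1
  Rule1Applies : ℕ → Set
  Rule1Applies k = Σ (Fin n) λ u → Σ (Fin n) λ v →
    u ≢ v × NE u v ×
    Σ (Fin (suc k) → Fin n) λ a → Σ (Fin (suc k) → Fin n) λ b →
      DisjointPairs a b ×
      (∀ i → E u (a i) × E v (a i) × E u (b i) × E v (b i) × NE (a i) (b i))

  -- rule (ii): edge uv with k+1 pairwise disjoint non-adjacent pairs
  -- {a,b}, a ∈ N(u) ∖ N[v], b ∈ N(v) ∖ N[u]
  Rule2Applies : ℕ → Set
  Rule2Applies k = Σ (Fin n) λ u → Σ (Fin n) λ v →
    E u v ×
    Σ (Fin (suc k) → Fin n) λ a → Σ (Fin (suc k) → Fin n) λ b →
      DisjointPairs a b ×
      (∀ i → E u (a i) × a i ≢ v × NE v (a i) ×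
             E v (b i) × b i ≢ u × NE u (b i) × NE (a i) (b i))

  Reduced : ℕ → Set
  Reduced k = ¬ Rule1Applies k × ¬ Rule2Applies k

  -- Universal clique decomposition of G - X.
  -- T is a rooted forest on nodes Fin m given by a parent map (roots have
  -- parent nothing) with no cycles; bag v p is the node t with v ∈ B_t.

  module Forest {m : ℕ} (parent : Fin m → Maybe (Fin m)) where
    -- Anc t s : t is a (strict) ancestor of s
    data Anc (t : Fin m) : Fin m → Set where
      here  : ∀ {s} → parent s ≡ just t → Anc t s
      there : ∀ {s r} → parent s ≡ just r → Anc t r → Anc t s

  record UCD (X : Subset n) : Set where
    field
      m      : ℕ
      parent : Fin m → Maybe (Fin m)
    open Forest parent public
    field
      acyclic  : ∀ t → ¬ Anc t t
      bag      : (v : Fin n) → OutX X v → Fin m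
      nonempty : ∀ t → Σ (Fin n) λ v → Σ (OutX X v) λ p → bag v p ≡ t
      edges    : ∀ v w (p : OutX X v) (q : OutX X w) → E v w →
                   bag v p ≡ bag w q ⊎ Anc (bag v p) (bag w q)
                                     ⊎ Anc (bag w q) (bag v p)

    -- v lies in ⋃_{s ∈ T_t} B_s
    Below : Fin m → (v : Fin n) → OutX X v → Set
    Below t v p = bag v p ≡ t ⊎ Anc t (bag v p)

    Universal : Fin m → (v : Fin n) → OutX X v → Set
    Universal t v p = Below t v p ×
      (∀ w (q : OutX X w) → Below t w q → w ≢ v → E v w)

    field
      universal : ∀ t v (p : OutX X v) →
                    (bag v p ≡ t → Universal t v p) ×
                    (Universal t v p → bag v p ≡ t)

    _⪯_ : (Σ (Fin n) (OutX X)) → (Σ (Fin n) (OutX X)) → Set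
    (u , p) ⪯ (v , q) = bag u p ≡ bag v q ⊎ Anc (bag u p) (bag v q)

    _≺_ : (Σ (Fin n) (OutX X)) → (Σ (Fin n) (OutX X)) → Set
    u ≺ v = u ⪯ v × ¬ (v ⪯ u)

-- Suppose u ≺ v, x ∈ X, xv ∈ E but xu ∉ E, and let t be the node whose bag
-- contains u. Since u is universal below t, u is adjacent to every other vertex
-- below t, in particular to v. If v missed some such w ≠ v, then x - v - u - w
-- would be an induced P₄ or C₄ meeting X in the single vertex x, which a
-- TP-modulator forbids. So v is universal below t as well, hence lies in B_t,
-- contradicting that v sits strictly below t.
module Submission where

open import Defs
open import Data.Nat using (ℕ; _≤_; s≤s)
open import Data.Fin using (Fin)
open import Data.Fin.Subset using (Subset)
open import Data.Bool using (true; false)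
import Data.Bool.Properties as Bool
open import Data.Product using (_,_; proj₁; proj₂)
open import Data.Sum using (_⊎_; inj₁; inj₂)
open import Data.Empty using (⊥; ⊥-elim)
open import Relation.Nullary using (¬_)
open import Relation.Binary.PropositionalEquality
open import Axiom.UniquenessOfIdentityProofs using (module Decidable⇒UIP)

module Adjacency (G : Graph) where
  open Graph G using (n; adj)
  private variable a b c d : Fin n

  E⊎NE : ∀ a b → E G a b ⊎ NE G a b
  E⊎NE a b with adj a b
  ... | true  = inj₁ refl
  ... | false = inj₂ refl

  E-sym : E G a b → E G b a
  E-sym {a} {b} eab = trans (Graph.sym G b a) eab

  NE-sym : NE G a b → NE G b a
  NE-sym {a} {b} nab = trans (Graph.sym G b a) nab

  E⇒≢ : E G a b → a ≢ b
  E⇒≢ {a} eab refl with () ← trans (sym eab) (Graph.irrefl G a)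

  E∧NE⇒≢ : E G a c → NE G b c → a ≢ b
  E∧NE⇒≢ eac nbc refl with () ← trans (sym eac) nbc

  path⇒Obstruction : Distinct4 G a b c d →
    E G a b → E G b c → E G c d → NE G a c → NE G b d → Obstruction G a b c d
  path⇒Obstruction {a} {b} {c} {d} dist eab ebc ecd nac nbd with E⊎NE d a
  ... | inj₁ eda = inj₂ (dist , eab , ebc , ecd , eda , nac , nbd)
  ... | inj₂ nda = inj₁ (dist , eab , ebc , ecd , nac , nbd , NE-sym nda)

module Modulator (G : Graph) (X : Subset (Graph.n G)) where
  open Graph G using (n)
  open Adjacency G
  private variable a b c d : Fin n

  InX⇒≢OutX : InX G X a → OutX G X b → a ≢ b
  InX⇒≢OutX ia ob refl with () ← trans (sym ia) ob

  count4-one-inside : InX G X a → OutX G X b → OutX G X c → OutX G X d →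
    count4 G X a b c d ≡ 1
  count4-one-inside ia ob oc od rewrite ia | ob | oc | od = refl

  ObstructionsMeetTwice : Set
  ObstructionsMeetTwice = ∀ a b c d → Obstruction G a b c d → 2 ≤ count4 G X a b c d

  ObstructionsMeetTwice⇒no-path-from-X :
    ObstructionsMeetTwice → InX G X a → OutX G X b → OutX G X c → OutX G X d →
    E G a b → E G b c → E G c d → NE G a c → NE G b d → b ≢ d → ⊥
  ObstructionsMeetTwice⇒no-path-from-X {a} {b} {c} {d} meet ia ob oc od eab ebc ecd nac nbd b≢d
    with meet a b c d (path⇒Obstruction dist eab ebc ecd nac nbd)
    where
    dist : Distinct4 G a b c d
    dist = InX⇒≢OutX ia ob , InX⇒≢OutX ia oc , InX⇒≢OutX ia od
         , E⇒≢ ebc , b≢d , E⇒≢ ecd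
  ... | two≤count rewrite count4-one-inside ia ob oc od with s≤s () ← two≤count

module _ {G : Graph} {X : Subset (Graph.n G)} (D : UCD G X) where
  open UCD D
  open Adjacency G
  open Modulator G X

  ≺⇒Anc : ∀ {u v p q} → (u , p) ≺ (v , q) → Anc (bag u p) (bag v q)
  ≺⇒Anc (inj₁ same , v⋠u) = ⊥-elim (v⋠u (inj₁ (sym same)))
  ≺⇒Anc (inj₂ anc  , _)   = anc

  ≺⇒≢ : ∀ {u v p q} → (u , p) ≺ (v , q) → u ≢ v
  ≺⇒≢ {u} {p = p} {q} u≺v refl
    rewrite Decidable⇒UIP.≡-irrelevant Bool._≟_ p q = acyclic _ (≺⇒Anc u≺v)

  universal-at-bag : ∀ v p → Universal (bag v p) v p
  universal-at-bag v p = proj₁ (universal (bag v p) v p) refl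

  ¬universal-strictly-below : ∀ {t v q} → Anc t (bag v q) → ¬ Universal t v q
  ¬universal-strictly-below {t} {v} {q} anc vU =
    acyclic t (subst (Anc t) (proj₂ (universal t v q) vU) anc)

  ≺-universal-unless-adjacent : ObstructionsMeetTwice →
    ∀ {u v p q x} → (u , p) ≺ (v , q) → InX G X x → E G v x → NE G u x →
    Universal (bag u p) v q
  ≺-universal-unless-adjacent meet {u} {v} {p} {q} {x} u≺v ix evx nux =
    inj₂ (≺⇒Anc u≺v) , adjacent-to-rest
    where
    euv : E G u v
    euv = proj₂ (universal-at-bag u p) v q (inj₂ (≺⇒Anc u≺v)) (≢-sym (≺⇒≢ u≺v))

    adjacent-to-rest : ∀ w q′ → Below (bag u p) w q′ → w ≢ v → E G v w
    adjacent-to-rest w q′ below w≢v with E⊎NE v w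
    ... | inj₁ evw = evw
    ... | inj₂ nvw = ⊥-elim
      (ObstructionsMeetTwice⇒no-path-from-X meet ix q p q′
        (E-sym evx) (E-sym euv) euw (NE-sym nux) nvw (≢-sym w≢v))
      where
      euw : E G u w
      euw = proj₂ (universal-at-bag u p) w q′ below
              (≢-sym (E∧NE⇒≢ euv (NE-sym nvw)))

lemma5 : (G : Graph) (k : ℕ) (X : Subset (Graph.n G)) →
    Reduced G k → IsSmallTPModulator G k X →
    (D : UCD G X) →
    ∀ u v (p : OutX G X u) (q : OutX G X v) →
    UCD._≺_ D (u , p) (v , q) →
    ∀ x → InX G X x → E G v x → E G u x
lemma5 G k X _ ((meet , _) , _) D u v p q u≺v x ix evx with Adjacency.E⊎NE G u x
... | inj₁ eux = eux
... | inj₂ nux = ⊥-elim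
  (¬universal-strictly-below D (≺⇒Anc D u≺v)
    (≺-universal-unless-adjacent D meet u≺v ix evx nux))
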